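{- Let $q$ be a complex number with $0<|q|<1$, let $a,b,u\in\mathbb{C}$ and let $c\in\mathbb{C}$ with $c\notin\{q^{ -j}: j\ge 0\}$. Then the formal power series $$f(z)={}_{2}\Phi_{1}\left(\begin{array}{c} a,b \\ c\end{array};q,u,z\right)=\sum_{n=0}^{\infty}u^{\binom{n}{2}}\frac{(a;q)_{n}(b;q)_{n}}{(q;q)_{n}(c;q)_{n}}z^{n}$$ satisfies the $q$-difference equation $$czD_{q}^{2}f(z)-abqz^{2}D_{q}^{2}f(uz)+(1-c)D_{q}f(z)+\big[(1-a)(1-b)-(1-abq)\big]zD_{q}f(uz)-(1-a)(1-b)f(uz)=0.$$
   Context: $(a;q)_0=1$, $(a;q)_n=\prod_{k=0}^{n-1}(1-aq^k)$. The $q$-differential operator acts by $D_q f(z)=\frac{f(z)-f(qz)}{z}$; on formal power series it is given by $D_q z^n=(1-q^n)z^{n-1}$. The notation $D_q^k f(uz)$ means $D_q^k$ applied to the function (formal power series) $z\mapsto f(uz)$. The convention $0^0=1$ is used in $u^{\binom{n}{2}}$. -}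

module Defs where

open import Level using (Level; _⊔_) renaming (suc to lsuc)
open import Data.Nat as ℕ using (ℕ; zero; suc)
open import Data.Nat.Combinatorics using (_C_)
open import Relation.Nullary using (¬_)
open import Algebra.Bundles using (CommutativeRing)

-- A field: a commutative ring with 0 ≉ 1 in which every nonzero element has
-- a multiplicative inverse (inverse given as a total function; its value at 0
-- is irrelevant).
record Field (c ℓ : Level) : Set (lsuc (c ⊔ ℓ)) where
  field
    commutativeRing : CommutativeRing c ℓ
  open CommutativeRing commutativeRing public
  field
    _⁻¹     : Carrier → Carrier
    ⁻¹-inverseʳ : ∀ x → ¬ (x ≈ 0#) → x * (x ⁻¹) ≈ 1#
    0≉1     : ¬ (0# ≈ 1#)

module FPS {c ℓ : Level} (K : Field c ℓ) where
  open Field K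

  pow : Carrier → ℕ → Carrier
  pow x zero    = 1#
  pow x (suc n) = x * pow x n

  poch : Carrier → Carrier → ℕ → Carrier
  poch a q zero    = 1#
  poch a q (suc n) = poch a q n * (1# - a * pow q n)

  Series : Set c
  Series = ℕ → Carrier

  phi21 : (a b cc q u : Carrier) → Series
  phi21 a b cc q u n =
    pow u (n C 2) * (poch a q n * poch b q n) * ((poch q q n * poch cc q n) ⁻¹)

  -- q-derivative: D_q z^n = (1 - q^n) z^(n-1)
  Dq : Carrier → Series → Series
  Dq q f n = (1# - pow q (suc n)) * f (suc n)

  dil : Carrier → Series → Series
  dil u f n = pow u n * f n

  mulZ : Series → Series
  mulZ f zero    = 0#
  mulZ f (suc n) = f n

  _·_ : Carrier → Series → Series
  (k · f) n = k * f n

  _⊕_ : Series → Series → Series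
  (f ⊕ g) n = f n + g n

  _⊖_ : Series → Series → Series
  (f ⊖ g) n = f n - g n

  infixl 6 _⊕_ _⊖_
  infixr 7 _·_

-- Coefficientwise, the operator on the left only relates neighbouring coefficients:
-- for every series f its n-th coefficient is
--   (1 - q ^ (n + 1)) (1 - c q ^ n) f (n + 1) - u ^ n (1 - a q ^ n) (1 - b q ^ n) f n.
-- For 2Φ1 this vanishes, because (x;q)_(n+1) = (x;q)_n (1 - x q ^ n) and
-- (n + 1 choose 2) = n + (n choose 2) give exactly this ratio of consecutive
-- coefficients; the hypotheses on q and c keep (q;q)_n (c;q)_n invertible.
module Submission where

open import Defs
open import Data.Nat as ℕ using (ℕ; zero; suc)
open import Relation.Nullary using (¬_; yes; no)

open import Algebra.Bundles using (CommutativeRing)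
open import Algebra.Solver.Ring.AlmostCommutativeRing
  using (fromCommutativeRing; _-Raw-AlmostCommutative⟶_)
open import Data.Integer as ℤ using (ℤ; +_; -[1+_]; sign; ∣_∣; _◃_)
import Data.Integer.Properties as ℤ
open import Data.Maybe using (Maybe; just; nothing)
open import Data.Nat.Combinatorics using (_C_; nCk+nC[k+1]≡[n+1]C[k+1]; nC1≡n)
import Data.Nat.Properties as ℕ
open import Data.Sign as Sign using (Sign)
open import Relation.Binary.PropositionalEquality as ≡ using (_≡_)

-- The ring solver decides equalities by normalising coefficients, so over an
-- arbitrary commutative ring it needs the coefficients ℤ and the canonical map ℤ → R.
module ℤ-RingSolver {c ℓ} (R : CommutativeRing c ℓ) where
  open CommutativeRing R
  open import Algebra.Properties.Ring ring
    using (-0#≈0#; -‿involutive; -‿+-comm; -‿distribˡ-*; -‿distribʳ-*)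
  open import Algebra.Properties.CommutativeSemigroup +-commutativeSemigroup using (interchange)
  -- This multiplication has 1 × x = x definitionally, so that con (+ 1) denotes 1#.
  open import Algebra.Properties.Semiring.Mult.TCOptimised semiring
    using (_×_; 1+×; ×-homo-+; ×1-homo-*)
  open import Relation.Binary.Reasoning.Setoid setoid

  fromℤ : ℤ → Carrier
  fromℤ (+ n)      = n × 1#
  fromℤ -[1+ n ] = - (suc n × 1#)

  private
    x≈x-0 : ∀ x → x ≈ x - 0#
    x≈x-0 x = sym (trans (+-congˡ -0#≈0#) (+-identityʳ x))

    [1+x]-[1+y]≈x-y : ∀ x y → (1# + x) - (1# + y) ≈ x - y
    [1+x]-[1+y]≈x-y x y = begin
      (1# + x) - (1# + y)        ≈⟨ +-congˡ (-‿+-comm 1# y) ⟨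
      (1# + x) + (- 1# + - y)    ≈⟨ interchange 1# x (- 1#) (- y) ⟩
      (1# - 1#) + (x - y)        ≈⟨ +-congʳ (-‿inverseʳ 1#) ⟩
      0# + (x - y)               ≈⟨ +-identityˡ (x - y) ⟩
      x - y                      ∎

  fromℤ-⊖ : ∀ m n → fromℤ (m ℤ.⊖ n) ≈ m × 1# - n × 1#
  fromℤ-⊖ m       zero    = x≈x-0 (m × 1#)
  fromℤ-⊖ zero    (suc n) = sym (+-identityˡ _)
  fromℤ-⊖ (suc m) (suc n) = begin
    fromℤ (suc m ℤ.⊖ suc n)          ≡⟨ ≡.cong fromℤ (ℤ.[1+m]⊖[1+n]≡m⊖n m n) ⟩
    fromℤ (m ℤ.⊖ n)                  ≈⟨ fromℤ-⊖ m n ⟩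
    m × 1# - n × 1#                  ≈⟨ [1+x]-[1+y]≈x-y (m × 1#) (n × 1#) ⟨
    (1# + m × 1#) - (1# + n × 1#)    ≈⟨ +-cong (1+× m 1#) (-‿cong (1+× n 1#)) ⟨
    suc m × 1# - suc n × 1#          ∎

  fromℤ-+ : ∀ i j → fromℤ (i ℤ.+ j) ≈ fromℤ i + fromℤ j
  fromℤ-+ (+ m)      (+ n)      = ×-homo-+ 1# m n
  fromℤ-+ (+ m)      -[1+ n ] = fromℤ-⊖ m (suc n)
  fromℤ-+ -[1+ m ] (+ n)      = trans (fromℤ-⊖ n (suc m)) (+-comm _ _)
  fromℤ-+ -[1+ m ] -[1+ n ] = begin
    - (suc (suc (m ℕ.+ n)) × 1#)      ≡⟨ ≡.cong (λ k → - (suc k × 1#)) (ℕ.+-suc m n) ⟨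
    - ((suc m ℕ.+ suc n) × 1#)        ≈⟨ -‿cong (×-homo-+ 1# (suc m) (suc n)) ⟩
    - (suc m × 1# + suc n × 1#)       ≈⟨ -‿+-comm _ _ ⟨
    - (suc m × 1#) + - (suc n × 1#)   ∎

  fromℤ-neg : ∀ i → fromℤ (ℤ.- i) ≈ - fromℤ i
  fromℤ-neg (+ zero)  = sym -0#≈0#
  fromℤ-neg (+ suc n) = refl
  fromℤ-neg -[1+ n ]  = sym (-‿involutive _)

  private
    signed : Sign → Carrier → Carrier
    signed Sign.+ x = x
    signed Sign.- x = - x

    signed-cong : ∀ s {x y} → x ≈ y → signed s x ≈ signed s y
    signed-cong Sign.+ x≈y = x≈y
    signed-cong Sign.- x≈y = -‿cong x≈y

    signed-* : ∀ s t x y → signed (s Sign.* t) (x * y) ≈ signed s x * signed t y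
    signed-* Sign.+ Sign.+ x y = refl
    signed-* Sign.+ Sign.- x y = -‿distribʳ-* x y
    signed-* Sign.- Sign.+ x y = -‿distribˡ-* x y
    signed-* Sign.- Sign.- x y = begin
      x * y            ≈⟨ -‿involutive (x * y) ⟨
      - - (x * y)      ≈⟨ -‿cong (-‿distribˡ-* x y) ⟩
      - (- x * y)      ≈⟨ -‿distribʳ-* (- x) y ⟩
      - x * - y        ∎

    fromℤ-◃ : ∀ s n → fromℤ (s ◃ n) ≈ signed s (n × 1#)
    fromℤ-◃ Sign.+   zero    = refl
    fromℤ-◃ Sign.-   zero    = sym -0#≈0#
    fromℤ-◃ Sign.+   (suc n) = refl
    fromℤ-◃ Sign.-   (suc n) = refl

    fromℤ-signed : ∀ i → fromℤ i ≡ signed (sign i) (∣ i ∣ × 1#)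
    fromℤ-signed (+ n)     = ≡.refl
    fromℤ-signed -[1+ n ] = ≡.refl

  fromℤ-* : ∀ i j → fromℤ (i ℤ.* j) ≈ fromℤ i * fromℤ j
  fromℤ-* i j = begin
    fromℤ (s ◃ (∣ i ∣ ℕ.* ∣ j ∣))               ≈⟨ fromℤ-◃ s (∣ i ∣ ℕ.* ∣ j ∣) ⟩
    signed s ((∣ i ∣ ℕ.* ∣ j ∣) × 1#)          ≈⟨ signed-cong s (×1-homo-* ∣ i ∣ ∣ j ∣) ⟩
    signed s (∣ i ∣ × 1# * ∣ j ∣ × 1#)         ≈⟨ signed-* (sign i) (sign j) _ _ ⟩
    signed (sign i) (∣ i ∣ × 1#) * signed (sign j) (∣ j ∣ × 1#)
      ≡⟨ ≡.cong₂ _*_ (fromℤ-signed i) (fromℤ-signed j) ⟨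
    fromℤ i * fromℤ j                            ∎
    where s = sign i Sign.* sign j

  fromℤ-homomorphism : ℤ.+-*-rawRing -Raw-AlmostCommutative⟶ fromCommutativeRing R
  fromℤ-homomorphism = record
    { ⟦_⟧    = fromℤ
    ; +-homo = fromℤ-+
    ; *-homo = fromℤ-*
    ; -‿homo = fromℤ-neg
    ; 0-homo = refl
    ; 1-homo = refl
    }

  private
    fromℤ-≟ : ∀ i j → Maybe (fromℤ i ≈ fromℤ j)
    fromℤ-≟ i j with i ℤ.≟ j
    ... | yes ≡.refl = just refl
    ... | no _       = nothing

  open import Algebra.Solver.Ring ℤ.+-*-rawRing (fromCommutativeRing R) fromℤ-homomorphism fromℤ-≟ public

  :1 : ∀ {n} → Polynomial n
  :1 = con (+ 1)

module FieldProperties {c ℓ} (K : Field c ℓ) where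
  open Field K
  open ℤ-RingSolver commutativeRing
  open import Algebra.Properties.Ring ring using (x∙y⁻¹≈ε⇒x≈y)
  open import Relation.Binary.Reasoning.Setoid setoid

  x*y≉0 : ∀ {x y} → ¬ (x ≈ 0#) → ¬ (y ≈ 0#) → ¬ (x * y ≈ 0#)
  x*y≉0 {x} {y} x≉0 y≉0 x*y≈0 = y≉0 (begin
    y                ≈⟨ *-identityˡ y ⟨
    1# * y           ≈⟨ *-congʳ (⁻¹-inverseʳ x x≉0) ⟨
    x * x ⁻¹ * y     ≈⟨ solve 3 (λ x x′ y → x :* x′ :* y := x′ :* (x :* y)) refl x (x ⁻¹) y ⟩
    x ⁻¹ * (x * y)   ≈⟨ *-congˡ x*y≈0 ⟩
    x ⁻¹ * 0#        ≈⟨ zeroʳ (x ⁻¹) ⟩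
    0#               ∎)

  1-x≉0 : ∀ {x} → ¬ (x ≈ 1#) → ¬ (1# - x ≈ 0#)
  1-x≉0 {x} x≉1 1-x≈0 = x≉1 (sym (x∙y⁻¹≈ε⇒x≈y 1# x 1-x≈0))

  z≈x*y⇒y*z⁻¹≈x⁻¹ : ∀ {x y z} → ¬ (z ≈ 0#) → z ≈ x * y → y * z ⁻¹ ≈ x ⁻¹
  z≈x*y⇒y*z⁻¹≈x⁻¹ {x} {y} {z} z≉0 z≈x*y = begin
    y * z ⁻¹                  ≈⟨ *-identityʳ (y * z ⁻¹) ⟨
    y * z ⁻¹ * 1#             ≈⟨ *-congˡ (⁻¹-inverseʳ x x≉0) ⟨
    y * z ⁻¹ * (x * x ⁻¹)     ≈⟨ solve 4 (λ x x′ y z′ → y :* z′ :* (x :* x′) := x :* y :* z′ :* x′)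
                                     refl x (x ⁻¹) y (z ⁻¹) ⟩
    x * y * z ⁻¹ * x ⁻¹       ≈⟨ *-congʳ (*-congʳ z≈x*y) ⟨
    z * z ⁻¹ * x ⁻¹           ≈⟨ *-congʳ (⁻¹-inverseʳ z z≉0) ⟩
    1# * x ⁻¹                 ≈⟨ *-identityˡ (x ⁻¹) ⟩
    x ⁻¹                      ∎
    where
    x≉0 : ¬ (x ≈ 0#)
    x≉0 x≈0 = z≉0 (trans z≈x*y (trans (*-congʳ x≈0) (zeroˡ y)))

module Phi21Series {c ℓ} (K : Field c ℓ) where
  open Field K
  open FPS K
  open FieldProperties K
  open ℤ-RingSolver commutativeRing
  open import Algebra.Properties.CommutativeSemigroup *-commutativeSemigroup using (interchange)
  open import Relation.Binary.Reasoning.Setoid setoid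

  pow-+ : ∀ x m n → pow x (m ℕ.+ n) ≈ pow x m * pow x n
  pow-+ x zero    n = sym (*-identityˡ (pow x n))
  pow-+ x (suc m) n = trans (*-congˡ (pow-+ x m n)) (sym (*-assoc x (pow x m) (pow x n)))

  pow-[1+n]C2 : ∀ x n → pow x (suc n C 2) ≈ pow x n * pow x (n C 2)
  pow-[1+n]C2 x n = trans (reflexive (≡.cong (pow x) [1+n]C2≡n+nC2)) (pow-+ x n (n C 2))
    where
    [1+n]C2≡n+nC2 : suc n C 2 ≡ n ℕ.+ n C 2
    [1+n]C2≡n+nC2 = ≡.trans (≡.sym (nCk+nC[k+1]≡[n+1]C[k+1] n 1)) (≡.cong (ℕ._+ n C 2) (nC1≡n n))

  poch≉0 : ∀ {a q} → (∀ k → ¬ (a * pow q k ≈ 1#)) → ∀ n → ¬ (poch a q n ≈ 0#)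
  poch≉0 a*qᵏ≉1 zero    1≈0 = 0≉1 (sym 1≈0)
  poch≉0 a*qᵏ≉1 (suc n) = x*y≉0 (poch≉0 a*qᵏ≉1 n) (1-x≉0 (a*qᵏ≉1 n))

  phi21-recurrence : ∀ {q a b c u} →
    (∀ k → ¬ (pow q (suc k) ≈ 1#)) → (∀ k → ¬ (c * pow q k ≈ 1#)) → ∀ n →
    (1# - q * pow q n) * (1# - c * pow q n) * phi21 a b c q u (suc n)
      ≈ pow u n * ((1# - a * pow q n) * (1# - b * pow q n)) * phi21 a b c q u n
  phi21-recurrence {q} {a} {b} {c} {u} qᵏ⁺¹≉1 c*qᵏ≉1 n = begin
    Q₁ * C₁ * (pow u (suc n C 2) * (poch a q n * A₁ * (poch b q n * B₁)) * P′ ⁻¹)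
      ≈⟨ *-congˡ (*-congʳ numerator) ⟩
    Q₁ * C₁ * (X * N * P′ ⁻¹)
      ≈⟨ solve 4 (λ QC X N P′⁻¹ → QC :* (X :* N :* P′⁻¹) := X :* (N :* (QC :* P′⁻¹)))
           refl (Q₁ * C₁) X N (P′ ⁻¹) ⟩
    X * (N * (Q₁ * C₁ * P′ ⁻¹))
      ≈⟨ *-congˡ (*-congˡ (z≈x*y⇒y*z⁻¹≈x⁻¹ P′≉0 (interchange (poch q q n) Q₁ (poch c q n) C₁))) ⟩
    X * (N * P ⁻¹)
      ∎
    where
    Q₁ C₁ A₁ B₁ X N P P′ : Carrier
    Q₁ = 1# - q * pow q n
    C₁ = 1# - c * pow q n
    A₁ = 1# - a * pow q n
    B₁ = 1# - b * pow q n
    X = pow u n * (A₁ * B₁)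
    N = pow u (n C 2) * (poch a q n * poch b q n)
    P = poch q q n * poch c q n
    P′ = poch q q (suc n) * poch c q (suc n)

    P′≉0 : ¬ (P′ ≈ 0#)
    P′≉0 = x*y≉0 (poch≉0 qᵏ⁺¹≉1 (suc n)) (poch≉0 c*qᵏ≉1 (suc n))

    numerator : pow u (suc n C 2) * (poch a q n * A₁ * (poch b q n * B₁)) ≈ X * N
    numerator = trans (*-congʳ (pow-[1+n]C2 u n))
      (solve 6 (λ uⁿ v α A β B → uⁿ :* v :* (α :* A :* (β :* B)) := uⁿ :* (A :* B) :* (v :* (α :* β)))
         refl (pow u n) (pow u (n C 2)) (poch a q n) A₁ (poch b q n) B₁)

  zDq-coefficient : ∀ q g n → mulZ (Dq q g) n ≈ (1# - pow q n) * g n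
  zDq-coefficient q g zero    = sym (trans (*-congʳ (-‿inverseʳ 1#)) (zeroˡ (g 0)))
  zDq-coefficient q g (suc n) = refl

  -- The factor q avoids the exponent n - 1, which would be wrong for n = 0.
  qz²Dq²-coefficient : ∀ q g n → q * mulZ (mulZ (Dq q (Dq q g))) n ≈ (q - pow q n) * mulZ (Dq q g) n
  qz²Dq²-coefficient q g zero    = trans (zeroʳ q) (sym (zeroʳ (q - 1#)))
  qz²Dq²-coefficient q g (suc n) = trans (*-congˡ (zDq-coefficient q (Dq q g) n))
    (solve 3 (λ q x D → q :* ((:1 :- x) :* D) := (q :- q :* x) :* D) refl q (pow q n) (Dq q g n))

  phi21Operator : (q a b c u : Carrier) → Series → Series
  phi21Operator q a b c u f =
    c · mulZ (Dq q (Dq q f))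
    ⊖ (a * b * q) · mulZ (mulZ (Dq q (Dq q (dil u f))))
    ⊕ (1# - c) · Dq q f
    ⊕ ((1# - a) * (1# - b) - (1# - a * b * q)) · mulZ (Dq q (dil u f))
    ⊖ ((1# - a) * (1# - b)) · dil u f

  phi21Operator-coefficient : ∀ q a b c u f n →
    phi21Operator q a b c u f n
      ≈ (1# - q * pow q n) * (1# - c * pow q n) * f (suc n)
        - pow u n * ((1# - a * pow q n) * (1# - b * pow q n)) * f n
  phi21Operator-coefficient q a b c u f n =
    trans (+-congʳ (+-cong (+-congʳ (+-cong (*-congˡ zD²f) (-‿cong abqz²D²fᵤ))) (*-congˡ zDfᵤ)))
      (solve 8 (λ a b c q x uⁿ F₀ F₁ →
          c :* ((:1 :- x) :* ((:1 :- q :* x) :* F₁))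
          :- a :* b :* ((q :- x) :* ((:1 :- x) :* (uⁿ :* F₀)))
          :+ (:1 :- c) :* ((:1 :- q :* x) :* F₁)
          :+ ((:1 :- a) :* (:1 :- b) :- (:1 :- a :* b :* q)) :* ((:1 :- x) :* (uⁿ :* F₀))
          :- (:1 :- a) :* (:1 :- b) :* (uⁿ :* F₀)
        := (:1 :- q :* x) :* (:1 :- c :* x) :* F₁ :- uⁿ :* ((:1 :- a :* x) :* (:1 :- b :* x)) :* F₀)
        refl a b c q (pow q n) (pow u n) (f n) (f (suc n)))
    where
    zD²f : mulZ (Dq q (Dq q f)) n ≈ (1# - pow q n) * Dq q f n
    zD²f = zDq-coefficient q (Dq q f) n

    zDfᵤ : mulZ (Dq q (dil u f)) n ≈ (1# - pow q n) * dil u f n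
    zDfᵤ = zDq-coefficient q (dil u f) n

    abqz²D²fᵤ : a * b * q * mulZ (mulZ (Dq q (Dq q (dil u f)))) n
                  ≈ a * b * ((q - pow q n) * ((1# - pow q n) * dil u f n))
    abqz²D²fᵤ = trans (*-assoc (a * b) q _)
      (*-congˡ (trans (qz²Dq²-coefficient q (dil u f) n) (*-congˡ zDfᵤ)))


mainTheorem1 : ∀ {ℓc ℓ} (K : Field ℓc ℓ) →
    let open Field K
        open FPS K
    in (q a b c u : Carrier) →
       ¬ (q ≈ 0#) →
       (∀ (n : ℕ) → ¬ (pow q (suc n) ≈ 1#)) →
       (∀ (j : ℕ) → ¬ (c * pow q j ≈ 1#)) →
       let f = phi21 a b c q u
           lhs = c · mulZ (Dq q (Dq q f))
                 ⊖ (a * b * q) · mulZ (mulZ (Dq q (Dq q (dil u f))))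
                 ⊕ (1# - c) · Dq q f
                 ⊕ ((1# - a) * (1# - b) - (1# - a * b * q)) · mulZ (Dq q (dil u f))
                 ⊖ ((1# - a) * (1# - b)) · dil u f
       in ∀ (n : ℕ) → lhs n ≈ 0#
mainTheorem1 K q a b c u _ qᵏ⁺¹≉1 c*qᵏ≉1 n = begin
  phi21Operator q a b c u f n
    ≈⟨ phi21Operator-coefficient q a b c u f n ⟩
  (1# - q * pow q n) * (1# - c * pow q n) * f (suc n)
    - pow u n * ((1# - a * pow q n) * (1# - b * pow q n)) * f n
    ≈⟨ x≈y⇒x∙y⁻¹≈ε (phi21-recurrence qᵏ⁺¹≉1 c*qᵏ≉1 n) ⟩
  0#
    ∎
  where
  open Field K
  open FPS K
  open Phi21Series K
  open import Algebra.Properties.Ring ring using (x≈y⇒x∙y⁻¹≈ε)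
  open import Relation.Binary.Reasoning.Setoid setoid

  f : Series
  f = phi21 a b c q u
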